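{- Let $\alpha(k)$ be the largest odd divisor of $k$, $G(n)=\sum_{k=1}^n\frac{n+1-k}{k}\alpha(k)$ and $g(n)=\frac{n(n+2)}{3}-G(n)$. For every nonnegative integer $m$, $$\max\{g(t): 2^m\le t<2^{m+1}\}=\frac19\left(m+\frac{\mathrm{round}(2^m/3)}{2^m}\right),$$ where $\mathrm{round}(\cdot)$ denotes the nearest integer.
   Context: $\alpha(k)$ is the largest odd divisor of the positive integer $k$. -}

module Defs where

open import Data.Nat as ℕ using (ℕ; zero; suc; _^_)
open import Data.Nat.Divisibility using (_∣?_)
open import Data.Integer as ℤ using (ℤ; +_)
open import Data.Rational as ℚ using (ℚ; _/_; round)
open import Relation.Nullary using (yes; no)
open import Data.Nat.Properties using (m^n≢0)

largestOddDivisorUpTo : ℕ → ℕ → ℕ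
largestOddDivisorUpTo k zero = zero
largestOddDivisorUpTo k (suc i) with 2 ∣? suc i | suc i ∣? k
... | no _  | yes _ = suc i
... | yes _ | _     = largestOddDivisorUpTo k i
... | no _  | no _  = largestOddDivisorUpTo k i

-- α(k): the largest odd divisor of k (for k ≥ 1; every divisor of k ≥ 1 is ≤ k)
α : ℕ → ℕ
α k = largestOddDivisorUpTo k k

Gsum : ℕ → ℕ → ℚ
Gsum n zero = ℚ.0ℚ
Gsum n (suc j) = Gsum n j ℚ.+ ((+ ((n ℕ.+ 1 ℕ.∸ suc j) ℕ.* α (suc j))) / suc j)

G : ℕ → ℚ
G n = Gsum n n

g : ℕ → ℚ
g n = ((+ (n ℕ.* (n ℕ.+ 2))) / 3) ℚ.- G n

bound : ℕ → ℚ
bound m = (ℤ.+ 1 / 9) ℚ.* ((+ m / 1) ℚ.+ (round ((+ (2 ^ m)) / 3) / (2 ^ m)))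
  where instance _ = m^n≢0 2 m

-- Since α(2k) = α(k) and α(2k+1) = 2k+1, the partial sums Σα n of α(k)/k satisfy
-- Σα(2n) = n + Σα(n)/2, and this turns into g(2n+1) = g(n) and g(2n+2) = mid (g(n+1)) (g(n))
-- with mid u v = (u + v)/2 + 1/6.  Hence the pairs (g(k+1), g(k)) with 2^m ≤ k+1 < 2^(m+1)
-- arise from (g 1, g 0) = (0, 0) by m applications of (u, v) ↦ (mid u v, v) or (u, mid u v).
-- The claimed maximum is p(m) = (m + J(m)/2^m)/9, J the Jacobsthal numbers (J(m) = round(2^m/3)).
-- It is increasing and p(m+1) = mid (p m) (p (m-1)) (reading p(-1) as p(0) = 0), so both maps
-- preserve "u, v ≤ p(m) and mid u v ≤ p(m+1)", while they send (p (m-1), p m) to (p (m+1), p m)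
-- and (p m, p (m-1)) to (p m, p (m+1)), so p(m) is attained on every level.

module Submission where

open import Defs
open import Data.Nat using (ℕ; _≤_; _<_; _^_; suc)
open import Data.Rational using (ℚ) renaming (_≤_ to _≤ℚ_)
open import Data.Product using (Σ; _×_)
open import Relation.Binary.PropositionalEquality using (_≡_)

open import Data.Bool using (false; true; T)
open import Data.Integer as ℤ using (+_; -[1+_])
import Data.Integer.Properties as ℤ
import Data.Integer.Tactic.RingSolver as ℤ-Solver
open import Data.Nat as ℕ using (zero; s≤s; z≤n; NonZero)
import Data.Nat.DivMod as ℕ
import Data.Nat.Properties as ℕ
import Data.Nat.Tactic.RingSolver as ℕ-Solver
open import Data.Nat.Coprimality using (Coprime; coprime-divisor)
open import Data.Nat.Divisibility using (_∣_; _∣?_; divides; ∣-refl; ∣-trans; ∣⇒≤; n∣m*n; 0∣⇒≡0)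
open import Data.Product using (_,_; proj₁; proj₂)
open import Data.Rational as ℚ using (mkℚ; _+_; _*_; _-_; _/_; ½; 0ℚ; 1ℚ; toℚᵘ; floor; round; _≤ᵇ_)
  renaming (_<_ to _<ℚ_)
import Data.Rational.Properties as ℚ
open import Data.Rational.Unnormalised as ℚᵘ using (mkℚᵘ; *≡*; _≃_)
import Data.Rational.Unnormalised.Properties as ℚᵘ
open import Data.Sum using (_⊎_; inj₁; inj₂)
open import Data.Unit using (tt)
open import Function.Bundles using (_⇔_; mk⇔; Equivalence)
open import Level using (0ℓ)
open import Relation.Binary.PropositionalEquality using (refl; sym; trans; cong; cong₂; subst; subst₂; module ≡-Reasoning)
open import Relation.Nullary using (¬_; yes; no; contradiction)
open import Relation.Nullary.Decidable using (dec⇒maybe)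
open import Tactic.RingSolver using (solve-∀)
import Tactic.RingSolver.Core.AlmostCommutativeRing as ACR

ℚ-ring : ACR.AlmostCommutativeRing 0ℓ 0ℓ
ℚ-ring = ACR.fromCommutativeRing ℚ.+-*-commutativeRing (λ x → dec⇒maybe (0ℚ ℚ.≟ x))

ι : ℕ → ℚ
ι n = + n / 1

-- Identities between normalised fractions are checked by cross-multiplication in ℚᵘ.
private
  toℚᵘ-/ : ∀ i d → toℚᵘ (i / suc d) ≃ mkℚᵘ i d
  toℚᵘ-/ i d = ℚ.toℚᵘ-fromℚᵘ (mkℚᵘ i d)

  toℚᵘ-+ : ∀ {p q P Q} → toℚᵘ p ≃ P → toℚᵘ q ≃ Q → toℚᵘ (p + q) ≃ P ℚᵘ.+ Q
  toℚᵘ-+ {p} {q} p≃P q≃Q = ℚᵘ.≃-trans (ℚ.toℚᵘ-homo-+ p q) (ℚᵘ.+-cong p≃P q≃Q)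

  toℚᵘ-* : ∀ {p q P Q} → toℚᵘ p ≃ P → toℚᵘ q ≃ Q → toℚᵘ (p * q) ≃ P ℚᵘ.* Q
  toℚᵘ-* {p} {q} p≃P q≃Q = ℚᵘ.≃-trans (ℚ.toℚᵘ-homo-* p q) (ℚᵘ.*-cong p≃P q≃Q)

  ≡-via-ℚᵘ : ∀ {p q P Q} → toℚᵘ p ≃ P → toℚᵘ q ≃ Q → P ≃ Q → p ≡ q
  ≡-via-ℚᵘ p≃P q≃Q P≃Q = ℚ.toℚᵘ-injective (ℚᵘ.≃-trans p≃P (ℚᵘ.≃-trans P≃Q (ℚᵘ.≃-sym q≃Q)))

ι-+ : ∀ m n → ι (m ℕ.+ n) ≡ ι m + ι n
ι-+ m n = ≡-via-ℚᵘ (toℚᵘ-/ (+ (m ℕ.+ n)) 0) (toℚᵘ-+ (toℚᵘ-/ (+ m) 0) (toℚᵘ-/ (+ n) 0))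
  (*≡* (trans (cong (ℤ._* + 1) (ℤ.pos-+ m n)) (cross (+ m) (+ n))))
  where
  cross : ∀ a b → (a ℤ.+ b) ℤ.* + 1 ≡ (a ℤ.* + 1 ℤ.+ b ℤ.* + 1) ℤ.* + 1
  cross = ℤ-Solver.solve-∀

ι-* : ∀ m n → ι (m ℕ.* n) ≡ ι m * ι n
ι-* m n = ≡-via-ℚᵘ (toℚᵘ-/ (+ (m ℕ.* n)) 0) (toℚᵘ-* (toℚᵘ-/ (+ m) 0) (toℚᵘ-/ (+ n) 0))
  (*≡* (cong (ℤ._* + 1) (ℤ.pos-* m n)))

ι-suc : ∀ n → ι (suc n) ≡ 1ℚ + ι n
ι-suc = ι-+ 1

/-as-* : ∀ n d → + n / suc d ≡ ι n * (+ 1 / suc d)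
/-as-* n d = ≡-via-ℚᵘ (toℚᵘ-/ (+ n) d) (toℚᵘ-* (toℚᵘ-/ (+ n) 0) (toℚᵘ-/ (+ 1) d)) (*≡* (cross (+ n) (+ suc d)))
  where
  cross : ∀ a b → a ℤ.* (+ 1 ℤ.* b) ≡ (a ℤ.* + 1) ℤ.* b
  cross = ℤ-Solver.solve-∀

n/n≡1 : ∀ d → + suc d / suc d ≡ 1ℚ
n/n≡1 d = ≡-via-ℚᵘ (toℚᵘ-/ (+ suc d) d) (toℚᵘ-/ (+ 1) 0) (*≡* (ℤ.*-comm (+ suc d) (+ 1)))

n/[2*d]≡½*n/d : ∀ n d .{{_ : NonZero d}} → _/_ (+ n) (2 ℕ.* d) {{ℕ.m*n≢0 2 d}} ≡ ½ * (+ n / d)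
n/[2*d]≡½*n/d n (suc d) =
  ≡-via-ℚᵘ (toℚᵘ-/ (+ n) (ℕ.pred (2 ℕ.* suc d))) (toℚᵘ-* (toℚᵘ-/ (+ 1) 1) (toℚᵘ-/ (+ n) d))
  (*≡* (trans (cong (+ n ℤ.*_) (ℤ.pos-* 2 (suc d))) (cross (+ n) (+ suc d))))
  where
  cross : ∀ a b → a ℤ.* (+ 2 ℤ.* b) ≡ (+ 1 ℤ.* a) ℤ.* (+ 2 ℤ.* b)
  cross = ℤ-Solver.solve-∀

odd⇒coprime-2 : ∀ {d} → ¬ 2 ∣ d → Coprime d 2
odd⇒coprime-2 2∤d {zero}  (_ , 0∣2) with () ← 0∣⇒≡0 0∣2
odd⇒coprime-2 2∤d {suc i} (i∣d , i∣2) with ∣⇒≤ i∣2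
... | s≤s z≤n       = refl
... | s≤s (s≤s z≤n) = contradiction i∣d 2∤d

odd∣2*⇒∣ : ∀ {d k} → ¬ 2 ∣ d → d ∣ 2 ℕ.* k → d ∣ k
odd∣2*⇒∣ 2∤d = coprime-divisor (odd⇒coprime-2 2∤d)

2∤odd : ∀ n → ¬ 2 ∣ suc (2 ℕ.* n)
2∤odd n (divides q eq) = ℕ.even≢odd q n (trans (ℕ.*-comm 2 q) (sym eq))

largestOddDivisorUpTo-2* : ∀ k i → largestOddDivisorUpTo (2 ℕ.* k) i ≡ largestOddDivisorUpTo k i
largestOddDivisorUpTo-2* k zero = refl
largestOddDivisorUpTo-2* k (suc i) with 2 ∣? suc i | suc i ∣? 2 ℕ.* k | suc i ∣? k
... | yes _   | _       | _       = largestOddDivisorUpTo-2* k i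
... | no _    | yes _   | yes _   = refl
... | no _    | no _    | no _    = largestOddDivisorUpTo-2* k i
... | no 2∤i  | yes i∣2k | no i∤k = contradiction (odd∣2*⇒∣ 2∤i i∣2k) i∤k
... | no _    | no i∤2k | yes i∣k = contradiction (∣-trans i∣k (n∣m*n 2)) i∤2k

largestOddDivisorUpTo-beyond : ∀ k i → largestOddDivisorUpTo (suc k) (i ℕ.+ suc k) ≡ α (suc k)
largestOddDivisorUpTo-beyond k zero = refl
largestOddDivisorUpTo-beyond k (suc i) with 2 ∣? suc (i ℕ.+ suc k) | suc (i ℕ.+ suc k) ∣? suc k
... | yes _ | _     = largestOddDivisorUpTo-beyond k i
... | no _  | no _  = largestOddDivisorUpTo-beyond k i
... | no _  | yes d∣k = contradiction (∣⇒≤ d∣k) (ℕ.<⇒≱ (s≤s (ℕ.m≤n+m (suc k) i)))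

α-2* : ∀ k → α (2 ℕ.* suc k) ≡ α (suc k)
α-2* k = trans (largestOddDivisorUpTo-2* (suc k) (2 ℕ.* suc k))
  (trans (cong (largestOddDivisorUpTo (suc k)) (cong (suc k ℕ.+_) (ℕ.+-identityʳ (suc k))))
         (largestOddDivisorUpTo-beyond k (suc k)))

α-odd : ∀ n → α (suc (2 ℕ.* n)) ≡ suc (2 ℕ.* n)
α-odd n with 2 ∣? suc (2 ℕ.* n) | suc (2 ℕ.* n) ∣? suc (2 ℕ.* n)
... | yes 2∣n | _      = contradiction 2∣n (2∤odd n)
... | no _    | yes _  = refl
... | no _    | no n∤n = contradiction ∣-refl n∤n

⅓ ⅙ : ℚ
⅓ = + 1 / 3
⅙ = + 1 / 6

αRatio : ℕ → ℚ
αRatio zero    = 0ℚ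
αRatio (suc n) = + α (suc n) / suc n

Σα : ℕ → ℚ
Σα zero    = 0ℚ
Σα (suc n) = Σα n + αRatio (suc n)

αRatio-odd : ∀ n → αRatio (suc (2 ℕ.* n)) ≡ 1ℚ
αRatio-odd n = trans (cong (λ a → + a / suc (2 ℕ.* n)) (α-odd n)) (n/n≡1 (2 ℕ.* n))

αRatio-2* : ∀ n → αRatio (2 ℕ.* suc n) ≡ ½ * αRatio (suc n)
αRatio-2* n = trans (cong (λ a → + a / (2 ℕ.* suc n)) (α-2* n)) (n/[2*d]≡½*n/d (α (suc n)) (suc n))

Σα-odd : ∀ n → Σα (suc (2 ℕ.* n)) ≡ Σα (2 ℕ.* n) + 1ℚ
Σα-odd n = cong (λ a → Σα (2 ℕ.* n) + a) (αRatio-odd n)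

Σα-2* : ∀ n → Σα (2 ℕ.* n) ≡ ι n + ½ * Σα n
Σα-2* zero    = refl
Σα-2* (suc n) = begin
  Σα (2 ℕ.* suc n)                                  ≡⟨ cong Σα (ℕ.*-suc 2 n) ⟩
  Σα (suc (2 ℕ.* n)) + αRatio (suc (suc (2 ℕ.* n)))  ≡⟨ cong₂ _+_ (Σα-odd n) (cong αRatio (sym (ℕ.*-suc 2 n))) ⟩
  Σα (2 ℕ.* n) + 1ℚ + αRatio (2 ℕ.* suc n)          ≡⟨ cong₂ (λ s a → s + 1ℚ + a) (Σα-2* n) (αRatio-2* n) ⟩
  ι n + ½ * Σα n + 1ℚ + ½ * αRatio (suc n)          ≡⟨ regroup (ι n) (Σα n) (αRatio (suc n)) ⟩
  (1ℚ + ι n) + ½ * (Σα n + αRatio (suc n))          ≡⟨ cong (_+ ½ * Σα (suc n)) (sym (ι-suc n)) ⟩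
  ι (suc n) + ½ * Σα (suc n)                         ∎
  where
  open ≡-Reasoning
  regroup : ∀ x s a → x + ½ * s + 1ℚ + ½ * a ≡ (1ℚ + x) + ½ * (s + a)
  regroup = solve-∀ ℚ-ring

drift : ℕ → ℚ
drift n = Σα n - (ι n + ι n) * ⅓

drift-2* : ∀ n → drift (2 ℕ.* n) ≡ ½ * drift n
drift-2* n = begin
  Σα (2 ℕ.* n) - (ι (2 ℕ.* n) + ι (2 ℕ.* n)) * ⅓          ≡⟨ cong₂ (λ s x → s - (x + x) * ⅓) (Σα-2* n) (ι-* 2 n) ⟩
  ι n + ½ * Σα n - (ι 2 * ι n + ι 2 * ι n) * ⅓           ≡⟨ identity (ι n) (Σα n) ⟩
  ½ * drift n                                            ∎
  where
  open ≡-Reasoning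
  identity : ∀ x s → x + ½ * s - (ι 2 * x + ι 2 * x) * ⅓ ≡ ½ * (s - (x + x) * ⅓)
  identity = solve-∀ ℚ-ring

drift-odd : ∀ n → drift (suc (2 ℕ.* n)) ≡ ½ * drift n + ⅓
drift-odd n = begin
  Σα (suc (2 ℕ.* n)) - (ι (suc (2 ℕ.* n)) + ι (suc (2 ℕ.* n))) * ⅓
    ≡⟨ cong₂ (λ s x → s - (x + x) * ⅓) (Σα-odd n) (trans (ι-suc (2 ℕ.* n)) (cong (λ a → 1ℚ + a) (ι-* 2 n))) ⟩
  Σα (2 ℕ.* n) + 1ℚ - ((1ℚ + ι 2 * ι n) + (1ℚ + ι 2 * ι n)) * ⅓
    ≡⟨ cong (λ s → s + 1ℚ - ((1ℚ + ι 2 * ι n) + (1ℚ + ι 2 * ι n)) * ⅓) (Σα-2* n) ⟩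
  ι n + ½ * Σα n + 1ℚ - ((1ℚ + ι 2 * ι n) + (1ℚ + ι 2 * ι n)) * ⅓
    ≡⟨ identity (ι n) (Σα n) ⟩
  ½ * drift n + ⅓ ∎
  where
  open ≡-Reasoning
  identity : ∀ x s → x + ½ * s + 1ℚ - ((1ℚ + ι 2 * x) + (1ℚ + ι 2 * x)) * ⅓ ≡ ½ * (s - (x + x) * ⅓) + ⅓
  identity = solve-∀ ℚ-ring

scale-/ : ∀ c y d → + (c ℕ.* y) / suc d ≡ ι c * (+ y / suc d)
scale-/ c y d = begin
  + (c ℕ.* y) / suc d               ≡⟨ /-as-* (c ℕ.* y) d ⟩
  ι (c ℕ.* y) * (+ 1 / suc d)       ≡⟨ cong (_* (+ 1 / suc d)) (ι-* c y) ⟩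
  ι c * ι y * (+ 1 / suc d)         ≡⟨ ℚ.*-assoc (ι c) (ι y) (+ 1 / suc d) ⟩
  ι c * (ι y * (+ 1 / suc d))       ≡⟨ cong (ι c *_) (sym (/-as-* y d)) ⟩
  ι c * (+ y / suc d)               ∎
  where open ≡-Reasoning

Gsum-suc : ∀ n j → j ≤ suc n → Gsum (suc n) j ≡ Gsum n j + Σα j
Gsum-suc n zero    _         = refl
Gsum-suc n (suc j) (s≤s j≤n) = begin
  Gsum (suc n) j + weighted (suc n ℕ.+ 1 ℕ.∸ suc j)
    ≡⟨ cong₂ _+_ (Gsum-suc n j (ℕ.m≤n⇒m≤1+n j≤n)) (cong weighted c+1) ⟩
  Gsum n j + Σα j + weighted (suc c)                     ≡⟨ cong (λ w → Gsum n j + Σα j + w) (scale-/ (suc c) (α (suc j)) j) ⟩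
  Gsum n j + Σα j + ι (suc c) * a                        ≡⟨ cong (λ x → Gsum n j + Σα j + x * a) (ι-suc c) ⟩
  Gsum n j + Σα j + (1ℚ + ι c) * a                       ≡⟨ regroup (Gsum n j) (Σα j) (ι c) a ⟩
  Gsum n j + ι c * a + (Σα j + a)
    ≡⟨ cong (λ w → Gsum n j + w + Σα (suc j)) (sym (scale-/ c (α (suc j)) j)) ⟩
  Gsum n j + weighted c + Σα (suc j)                     ∎
  where
  open ≡-Reasoning
  a = αRatio (suc j)
  c = n ℕ.+ 1 ℕ.∸ suc j
  weighted : ℕ → ℚ
  weighted k = + (k ℕ.* α (suc j)) / suc j
  c+1 : suc n ℕ.+ 1 ℕ.∸ suc j ≡ suc c
  c+1 rewrite ℕ.+-comm n 1 = ℕ.+-∸-assoc 1 j≤n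
  regroup : ∀ G s x a → G + s + (1ℚ + x) * a ≡ G + x * a + (s + a)
  regroup = solve-∀ ℚ-ring

G-suc : ∀ n → G (suc n) ≡ G n + Σα (suc n)
G-suc n = trans (Gsum-suc n (suc n) ℕ.≤-refl) (cong (_+ Σα (suc n)) Gsum-n-suc)
  where
  open ≡-Reasoning
  no-weight : n ℕ.+ 1 ℕ.∸ suc n ≡ 0
  no-weight rewrite ℕ.+-comm n 1 = ℕ.n∸n≡0 n
  Gsum-n-suc : Gsum n (suc n) ≡ G n
  Gsum-n-suc = begin
    G n + + ((n ℕ.+ 1 ℕ.∸ suc n) ℕ.* α (suc n)) / suc n  ≡⟨ cong (λ k → G n + + (k ℕ.* α (suc n)) / suc n) no-weight ⟩
    G n + + (0 ℕ.* α (suc n)) / suc n                    ≡⟨ cong (λ w → G n + w) (scale-/ 0 (α (suc n)) n) ⟩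
    G n + 0ℚ * αRatio (suc n)                            ≡⟨ cong (λ w → G n + w) (ℚ.*-zeroˡ (αRatio (suc n))) ⟩
    G n + 0ℚ                                             ≡⟨ ℚ.+-identityʳ (G n) ⟩
    G n                                                  ∎

g-formula : ∀ n → g n ≡ ι n * (ι n + ι 2) * ⅓ - G n
g-formula n = cong (_- G n) (begin
  + (n ℕ.* (n ℕ.+ 2)) / 3          ≡⟨ /-as-* (n ℕ.* (n ℕ.+ 2)) 2 ⟩
  ι (n ℕ.* (n ℕ.+ 2)) * ⅓          ≡⟨ cong (_* ⅓) (trans (ι-* n (n ℕ.+ 2)) (cong (ι n *_) (ι-+ n 2))) ⟩
  ι n * (ι n + ι 2) * ⅓            ∎)
  where open ≡-Reasoning

g-suc : ∀ n → g (suc n) ≡ g n + (⅓ - drift (suc n))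
g-suc n = begin
  g (suc n)                                                              ≡⟨ g-formula (suc n) ⟩
  ι (suc n) * (ι (suc n) + ι 2) * ⅓ - G (suc n)
    ≡⟨ cong₂ (λ x G′ → x * (x + ι 2) * ⅓ - G′) (ι-suc n) (G-suc n) ⟩
  (1ℚ + ι n) * ((1ℚ + ι n) + ι 2) * ⅓ - (G n + Σα (suc n))               ≡⟨ identity (ι n) (G n) (Σα (suc n)) ⟩
  ι n * (ι n + ι 2) * ⅓ - G n + (⅓ - (Σα (suc n) - ((1ℚ + ι n) + (1ℚ + ι n)) * ⅓))
    ≡⟨ cong₂ (λ g′ x → g′ + (⅓ - (Σα (suc n) - (x + x) * ⅓))) (sym (g-formula n)) (sym (ι-suc n)) ⟩
  g n + (⅓ - drift (suc n))                                              ∎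
  where
  open ≡-Reasoning
  identity : ∀ x G s → (1ℚ + x) * ((1ℚ + x) + ι 2) * ⅓ - (G + s)
                     ≡ x * (x + ι 2) * ⅓ - G + (⅓ - (s - ((1ℚ + x) + (1ℚ + x)) * ⅓))
  identity = solve-∀ ℚ-ring

mid : ℚ → ℚ → ℚ
mid u v = ½ * (u + v) + ⅙

mutual
  g-odd : ∀ n → g (suc (2 ℕ.* n)) ≡ g n
  g-odd zero    = refl
  g-odd (suc n) = begin
    g (suc (2 ℕ.* suc n))                                               ≡⟨ g-suc (2 ℕ.* suc n) ⟩
    g (2 ℕ.* suc n) + (⅓ - drift (suc (2 ℕ.* suc n)))
      ≡⟨ cong₂ (λ x d → x + (⅓ - d)) (trans (cong g (ℕ.*-suc 2 n)) (g-even-drift n)) (drift-odd (suc n)) ⟩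
    g n + (⅓ - ½ * drift (suc n)) + (⅓ - (½ * drift (suc n) + ⅓))       ≡⟨ identity (g n) (drift (suc n)) ⟩
    g n + (⅓ - drift (suc n))                                           ≡⟨ sym (g-suc n) ⟩
    g (suc n)                                                           ∎
    where
    open ≡-Reasoning
    identity : ∀ x d → x + (⅓ - ½ * d) + (⅓ - (½ * d + ⅓)) ≡ x + (⅓ - d)
    identity = solve-∀ ℚ-ring

  g-even-drift : ∀ n → g (suc (suc (2 ℕ.* n))) ≡ g n + (⅓ - ½ * drift (suc n))
  g-even-drift n = begin
    g (suc (suc (2 ℕ.* n)))                               ≡⟨ g-suc (suc (2 ℕ.* n)) ⟩
    g (suc (2 ℕ.* n)) + (⅓ - drift (suc (suc (2 ℕ.* n))))
      ≡⟨ cong₂ (λ x d → x + (⅓ - d)) (g-odd n) (cong drift (sym (ℕ.*-suc 2 n))) ⟩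
    g n + (⅓ - drift (2 ℕ.* suc n))                       ≡⟨ cong (λ d → g n + (⅓ - d)) (drift-2* (suc n)) ⟩
    g n + (⅓ - ½ * drift (suc n))                         ∎
    where open ≡-Reasoning

g-even : ∀ n → g (suc (suc (2 ℕ.* n))) ≡ mid (g (suc n)) (g n)
g-even n = begin
  g (suc (suc (2 ℕ.* n)))                        ≡⟨ g-even-drift n ⟩
  g n + (⅓ - ½ * drift (suc n))                  ≡⟨ identity (g n) (drift (suc n)) ⟩
  mid (g n + (⅓ - drift (suc n))) (g n)          ≡⟨ cong (λ x → mid x (g n)) (sym (g-suc n)) ⟩
  mid (g (suc n)) (g n)                          ∎
  where
  open ≡-Reasoning
  identity : ∀ x d → x + (⅓ - ½ * d) ≡ ½ * ((x + (⅓ - d)) + x) + ⅙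
  identity = solve-∀ ℚ-ring

g-odd-suc : ∀ n → g (suc (suc (suc (2 ℕ.* n)))) ≡ g (suc n)
g-odd-suc n = trans (cong (λ k → g (suc k)) (sym (ℕ.*-suc 2 n))) (g-odd (suc n))

jacobsthal : ℕ → ℕ
jacobsthal 0                  = 0
jacobsthal 1                  = 1
jacobsthal (suc (suc m))      = jacobsthal (suc m) ℕ.+ 2 ℕ.* jacobsthal m

jacobsthal-suc-+ : ∀ m → jacobsthal (suc m) ℕ.+ jacobsthal m ≡ 2 ^ m
jacobsthal-suc-+ zero    = refl
jacobsthal-suc-+ (suc m) = trans (regroup (jacobsthal (suc m)) (jacobsthal m)) (cong (2 ℕ.*_) (jacobsthal-suc-+ m))
  where
  regroup : ∀ a b → a ℕ.+ 2 ℕ.* b ℕ.+ a ≡ 2 ℕ.* (a ℕ.+ b)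
  regroup = ℕ-Solver.solve-∀

3*jacobsthal≡2^∓1 : ∀ m → 3 ℕ.* jacobsthal m ℕ.+ 1 ≡ 2 ^ m ⊎ 3 ℕ.* jacobsthal m ≡ 2 ^ m ℕ.+ 1
3*jacobsthal≡2^∓1 zero = inj₁ refl
3*jacobsthal≡2^∓1 (suc m) with 3*jacobsthal≡2^∓1 m
... | inj₁ 3b+1≡P = inj₂ (ℕ.+-cancelʳ-≡ (2 ^ m) _ _ (begin
  3 ℕ.* a ℕ.+ 2 ^ m               ≡⟨ cong (3 ℕ.* a ℕ.+_) (sym 3b+1≡P) ⟩
  3 ℕ.* a ℕ.+ (3 ℕ.* b ℕ.+ 1)     ≡⟨ regroup a b ⟩
  3 ℕ.* (a ℕ.+ b) ℕ.+ 1           ≡⟨ cong (λ x → 3 ℕ.* x ℕ.+ 1) (jacobsthal-suc-+ m) ⟩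
  3 ℕ.* 2 ^ m ℕ.+ 1               ≡⟨ regroup′ (2 ^ m) ⟩
  2 ^ suc m ℕ.+ 1 ℕ.+ 2 ^ m       ∎))
  where
  open ≡-Reasoning
  a = jacobsthal (suc m)
  b = jacobsthal m
  regroup : ∀ a b → 3 ℕ.* a ℕ.+ (3 ℕ.* b ℕ.+ 1) ≡ 3 ℕ.* (a ℕ.+ b) ℕ.+ 1
  regroup = ℕ-Solver.solve-∀
  regroup′ : ∀ p → 3 ℕ.* p ℕ.+ 1 ≡ 2 ℕ.* p ℕ.+ 1 ℕ.+ p
  regroup′ = ℕ-Solver.solve-∀
... | inj₂ 3b≡P+1 = inj₁ (ℕ.+-cancelʳ-≡ (2 ^ m) _ _ (begin
  3 ℕ.* a ℕ.+ 1 ℕ.+ 2 ^ m         ≡⟨ regroup a (2 ^ m) ⟩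
  3 ℕ.* a ℕ.+ (2 ^ m ℕ.+ 1)       ≡⟨ cong (3 ℕ.* a ℕ.+_) (sym 3b≡P+1) ⟩
  3 ℕ.* a ℕ.+ 3 ℕ.* b             ≡⟨ sym (ℕ.*-distribˡ-+ 3 a b) ⟩
  3 ℕ.* (a ℕ.+ b)                 ≡⟨ cong (3 ℕ.*_) (jacobsthal-suc-+ m) ⟩
  3 ℕ.* 2 ^ m                     ≡⟨ regroup′ (2 ^ m) ⟩
  2 ^ suc m ℕ.+ 2 ^ m             ∎))
  where
  open ≡-Reasoning
  a = jacobsthal (suc m)
  b = jacobsthal m
  regroup : ∀ a p → 3 ℕ.* a ℕ.+ 1 ℕ.+ p ≡ 3 ℕ.* a ℕ.+ (p ℕ.+ 1)
  regroup = ℕ-Solver.solve-∀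
  regroup′ : ∀ p → 3 ℕ.* p ≡ 2 ℕ.* p ℕ.+ p
  regroup′ = ℕ-Solver.solve-∀

[r+k*d]/d≡k : ∀ r k d .{{_ : NonZero d}} → r < d → (r ℕ.+ k ℕ.* d) ℕ./ d ≡ k
[r+k*d]/d≡k r k d r<d = begin
  (r ℕ.+ k ℕ.* d) ℕ./ d          ≡⟨ ℕ.+-distrib-/-∣ʳ r (n∣m*n k) ⟩
  r ℕ./ d ℕ.+ k ℕ.* d ℕ./ d      ≡⟨ cong₂ ℕ._+_ (ℕ.m<n⇒m/n≡0 r<d) (ℕ.m*n/n≡m k d) ⟩
  k                              ∎
  where open ≡-Reasoning

[2^[1+m]+3]/6≡jacobsthal : ∀ m → (2 ^ suc m ℕ.+ 3) ℕ./ 6 ≡ jacobsthal m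
[2^[1+m]+3]/6≡jacobsthal m with 3*jacobsthal≡2^∓1 m
... | inj₁ 3j+1≡P = trans (cong (ℕ._/ 6) (begin
  2 ℕ.* 2 ^ m ℕ.+ 3               ≡⟨ cong (λ p → 2 ℕ.* p ℕ.+ 3) (sym 3j+1≡P) ⟩
  2 ℕ.* (3 ℕ.* j ℕ.+ 1) ℕ.+ 3     ≡⟨ regroup j ⟩
  5 ℕ.+ j ℕ.* 6                   ∎))
  ([r+k*d]/d≡k 5 j 6 (ℕ.n<1+n 5))
  where
  open ≡-Reasoning
  j = jacobsthal m
  regroup : ∀ j → 2 ℕ.* (3 ℕ.* j ℕ.+ 1) ℕ.+ 3 ≡ 5 ℕ.+ j ℕ.* 6
  regroup = ℕ-Solver.solve-∀
... | inj₂ 3j≡P+1 = trans (cong (ℕ._/ 6) (begin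
  2 ℕ.* 2 ^ m ℕ.+ 3               ≡⟨ regroup (2 ^ m) ⟩
  2 ℕ.* (2 ^ m ℕ.+ 1) ℕ.+ 1       ≡⟨ cong (λ p → 2 ℕ.* p ℕ.+ 1) (sym 3j≡P+1) ⟩
  2 ℕ.* (3 ℕ.* j) ℕ.+ 1           ≡⟨ regroup′ j ⟩
  1 ℕ.+ j ℕ.* 6                   ∎))
  ([r+k*d]/d≡k 1 j 6 (s≤s (s≤s z≤n)))
  where
  open ≡-Reasoning
  j = jacobsthal m
  regroup : ∀ p → 2 ℕ.* p ℕ.+ 3 ≡ 2 ℕ.* (p ℕ.+ 1) ℕ.+ 1
  regroup = ℕ-Solver.solve-∀
  regroup′ : ∀ j → 2 ℕ.* (3 ℕ.* j) ℕ.+ 1 ≡ 1 ℕ.+ j ℕ.* 6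
  regroup′ = ℕ-Solver.solve-∀

cross-/ : ∀ {x d n e} → x ℕ.* suc e ≡ n ℕ.* suc d → x ℕ./ suc d ≡ n ℕ./ suc e
cross-/ {x} {d} {n} {e} eq = begin
  x ℕ./ suc d                          ≡⟨ sym (ℕ.m*n/o*n≡m/o x (suc e) (suc d)) ⟩
  x ℕ.* suc e ℕ./ (suc d ℕ.* suc e)    ≡⟨ cong (ℕ._/ (suc d ℕ.* suc e)) eq ⟩
  n ℕ.* suc d ℕ./ (suc d ℕ.* suc e)    ≡⟨ ℕ./-congʳ {m = n ℕ.* suc d} (ℕ.*-comm (suc d) (suc e)) ⟩
  n ℕ.* suc d ℕ./ (suc e ℕ.* suc d)    ≡⟨ ℕ.m*n/o*n≡m/o n (suc d) (suc e) ⟩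
  n ℕ./ suc e                          ∎
  where open ≡-Reasoning

floor-/ : ∀ n d → floor (+ n / suc d) ≡ + (n ℕ./ suc d)
floor-/ n d = floor-≃ (+ n / suc d) (toℚᵘ-/ (+ n) d)
  where
  floor-≃ : ∀ p → toℚᵘ p ≃ mkℚᵘ (+ n) d → floor p ≡ + (n ℕ./ suc d)
  floor-≃ (mkℚ (+ x) e _) (*≡* eq) = trans (ℤ.*-identityˡ (+ (x ℕ./ suc e)))
    (cong +_ (cross-/ {x} {e} {n} {d} (ℤ.+-injective (trans (ℤ.pos-* x (suc d)) (trans eq (sym (ℤ.pos-* n (suc e))))))))
  floor-≃ (mkℚ -[1+ x ] e _) (*≡* eq) with () ← trans eq (sym (ℤ.pos-* n (suc e)))

round-pos : ∀ {q} → 0ℚ <ℚ q → round q ≡ floor (q + ½)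
round-pos {q} 0<q with q ≤ᵇ 0ℚ in q≤ᵇ0
... | false = refl
... | true  = contradiction (ℚ.<-≤-trans 0<q (ℚ.≤ᵇ⇒≤ (subst T (sym q≤ᵇ0) tt))) (ℚ.<-irrefl refl)

2^m/3+½ : ∀ m → + 2 ^ m / 3 + ½ ≡ + (2 ^ suc m ℕ.+ 3) / 6
2^m/3+½ m = ≡-via-ℚᵘ (toℚᵘ-+ (toℚᵘ-/ (+ 2 ^ m) 2) (toℚᵘ-/ (+ 1) 1)) (toℚᵘ-/ (+ (2 ^ suc m ℕ.+ 3)) 5)
  (*≡* (trans (cross (+ 2 ^ m)) (cong (ℤ._* + 6) (sym (trans (ℤ.pos-+ (2 ^ suc m) 3) (cong (ℤ._+ + 3) (ℤ.pos-* 2 (2 ^ m))))))))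
  where
  cross : ∀ p → (p ℤ.* + 2 ℤ.+ + 1 ℤ.* + 3) ℤ.* + 6 ≡ (+ 2 ℤ.* p ℤ.+ + 3) ℤ.* + 6
  cross = ℤ-Solver.solve-∀

round[2^m/3]≡jacobsthal : ∀ m → round (+ 2 ^ m / 3) ≡ + jacobsthal m
round[2^m/3]≡jacobsthal m = begin
  round (+ 2 ^ m / 3)                  ≡⟨ round-pos {+ 2 ^ m / 3} 0<2^m/3 ⟩
  floor (+ 2 ^ m / 3 + ½)              ≡⟨ cong floor (2^m/3+½ m) ⟩
  floor (+ (2 ^ suc m ℕ.+ 3) / 6)      ≡⟨ floor-/ (2 ^ suc m ℕ.+ 3) 5 ⟩
  + ((2 ^ suc m ℕ.+ 3) ℕ./ 6)          ≡⟨ cong +_ ([2^[1+m]+3]/6≡jacobsthal m) ⟩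
  + jacobsthal m                       ∎
  where
  open ≡-Reasoning
  0<2^m/3 : 0ℚ <ℚ + 2 ^ m / 3
  0<2^m/3 = ℚ.positive⁻¹ _ {{ℚ.normalize-pos (2 ^ m) 3 {{_}} {{ℕ.m^n≢0 2 m}}}}

½^ : ℕ → ℚ
½^ zero    = 1ℚ
½^ (suc m) = ½ * ½^ m

n/2^m≡n*½^m : ∀ n m → _/_ (+ n) (2 ^ m) {{ℕ.m^n≢0 2 m}} ≡ ι n * ½^ m
n/2^m≡n*½^m n zero    = sym (ℚ.*-identityʳ (ι n))
n/2^m≡n*½^m n (suc m) = begin
  _/_ (+ n) (2 ^ suc m) {{ℕ.m^n≢0 2 (suc m)}}  ≡⟨ n/[2*d]≡½*n/d n (2 ^ m) {{ℕ.m^n≢0 2 m}} ⟩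
  ½ * _/_ (+ n) (2 ^ m) {{ℕ.m^n≢0 2 m}}         ≡⟨ cong (½ *_) (n/2^m≡n*½^m n m) ⟩
  ½ * (ι n * ½^ m)                               ≡⟨ swap ½ (ι n) (½^ m) ⟩
  ι n * (½ * ½^ m)                               ∎
  where
  open ≡-Reasoning
  swap : ∀ a b c → a * (b * c) ≡ b * (a * c)
  swap = solve-∀ ℚ-ring

⅑ : ℚ
⅑ = + 1 / 9

jacobsthalRatio : ℕ → ℚ
jacobsthalRatio m = ι (jacobsthal m) * ½^ m

peak : ℕ → ℚ
peak m = ⅑ * (ι m + jacobsthalRatio m)

bound≡peak : ∀ m → bound m ≡ peak m
bound≡peak m = cong (λ r → ⅑ * (ι m + r)) (begin
  _/_ (round (+ 2 ^ m / 3)) (2 ^ m) {{ℕ.m^n≢0 2 m}}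
    ≡⟨ cong (λ r → _/_ r (2 ^ m) {{ℕ.m^n≢0 2 m}}) (round[2^m/3]≡jacobsthal m) ⟩
  _/_ (+ jacobsthal m) (2 ^ m) {{ℕ.m^n≢0 2 m}}         ≡⟨ n/2^m≡n*½^m (jacobsthal m) m ⟩
  jacobsthalRatio m                                    ∎)
  where open ≡-Reasoning

½*+-mono-≤ : ∀ {u u′ v v′} → u ≤ℚ u′ → v ≤ℚ v′ → ½ * (u + v) ≤ℚ ½ * (u′ + v′)
½*+-mono-≤ u≤u′ v≤v′ = ℚ.*-monoˡ-≤-nonNeg ½ (ℚ.+-mono-≤ u≤u′ v≤v′)

½*+-unit-interval : ∀ {a b} → 0ℚ ≤ℚ a × a ≤ℚ 1ℚ → 0ℚ ≤ℚ b × b ≤ℚ 1ℚ → 0ℚ ≤ℚ ½ * (a + b) × ½ * (a + b) ≤ℚ 1ℚ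
½*+-unit-interval {a} {b} (0≤a , a≤1) (0≤b , b≤1) =
  subst₂ _≤ℚ_ ½*[0+0]≡0 refl (½*+-mono-≤ 0≤a 0≤b) , subst₂ _≤ℚ_ refl ½*[1+1]≡1 (½*+-mono-≤ a≤1 b≤1)
  where
  ½*[0+0]≡0 : ½ * (0ℚ + 0ℚ) ≡ 0ℚ
  ½*[0+0]≡0 = refl
  ½*[1+1]≡1 : ½ * (1ℚ + 1ℚ) ≡ 1ℚ
  ½*[1+1]≡1 = refl

jacobsthalRatio-rec : ∀ m → jacobsthalRatio (suc (suc m)) ≡ ½ * (jacobsthalRatio (suc m) + jacobsthalRatio m)
jacobsthalRatio-rec m = begin
  ι (a ℕ.+ 2 ℕ.* b) * (½ * (½ * ½^ m))
    ≡⟨ cong (_* (½ * (½ * ½^ m))) (trans (ι-+ a (2 ℕ.* b)) (cong (λ y → ι a + y) (ι-* 2 b))) ⟩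
  (ι a + ι 2 * ι b) * (½ * (½ * ½^ m))     ≡⟨ identity (ι a) (ι b) (½^ m) ⟩
  ½ * (ι a * (½ * ½^ m) + ι b * ½^ m)      ∎
  where
  open ≡-Reasoning
  a = jacobsthal (suc m)
  b = jacobsthal m
  identity : ∀ x y h → (x + ι 2 * y) * (½ * (½ * h)) ≡ ½ * (x * (½ * h) + y * h)
  identity = solve-∀ ℚ-ring

jacobsthalRatio-bounds : ∀ m → 0ℚ ≤ℚ jacobsthalRatio m × jacobsthalRatio m ≤ℚ 1ℚ
jacobsthalRatio-bounds 0             = ℚ.≤ᵇ⇒≤ _ , ℚ.≤ᵇ⇒≤ _
jacobsthalRatio-bounds 1             = ℚ.≤ᵇ⇒≤ _ , ℚ.≤ᵇ⇒≤ _
jacobsthalRatio-bounds (suc (suc m)) = subst (λ r → 0ℚ ≤ℚ r × r ≤ℚ 1ℚ) (sym (jacobsthalRatio-rec m))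
  (½*+-unit-interval (jacobsthalRatio-bounds (suc m)) (jacobsthalRatio-bounds m))

peak-suc : ∀ m → peak (suc m) ≡ mid (peak m) (peak (ℕ.pred m))
peak-suc zero    = refl
peak-suc (suc m) = begin
  ⅑ * (ι (suc (suc m)) + jacobsthalRatio (suc (suc m)))
    ≡⟨ cong₂ (λ x r → ⅑ * (x + r)) (trans (ι-suc (suc m)) (cong (λ y → 1ℚ + y) (ι-suc m))) (jacobsthalRatio-rec m) ⟩
  ⅑ * ((1ℚ + (1ℚ + ι m)) + ½ * (jacobsthalRatio (suc m) + jacobsthalRatio m))
    ≡⟨ identity (ι m) (jacobsthalRatio (suc m)) (jacobsthalRatio m) ⟩
  ½ * (⅑ * ((1ℚ + ι m) + jacobsthalRatio (suc m)) + ⅑ * (ι m + jacobsthalRatio m)) + ⅙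
    ≡⟨ cong (λ x → ½ * (⅑ * (x + jacobsthalRatio (suc m)) + peak m) + ⅙) (sym (ι-suc m)) ⟩
  mid (peak (suc m)) (peak m) ∎
  where
  open ≡-Reasoning
  identity : ∀ x a b → ⅑ * ((1ℚ + (1ℚ + x)) + ½ * (a + b)) ≡ ½ * (⅑ * ((1ℚ + x) + a) + ⅑ * (x + b)) + ⅙
  identity = solve-∀ ℚ-ring

peak-mono : ∀ m → peak m ≤ℚ peak (suc m)
peak-mono m = begin
  ⅑ * (ι m + jacobsthalRatio m)              ≤⟨ ℚ.*-monoˡ-≤-nonNeg ⅑ (ℚ.+-monoʳ-≤ (ι m) (proj₂ (jacobsthalRatio-bounds m))) ⟩
  ⅑ * (ι m + 1ℚ)                             ≡⟨ cong (⅑ *_) m+1≡[1+m]+0 ⟩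
  ⅑ * (ι (suc m) + 0ℚ)                       ≤⟨ ℚ.*-monoˡ-≤-nonNeg ⅑ (ℚ.+-monoʳ-≤ (ι (suc m)) 0≤ratio) ⟩
  ⅑ * (ι (suc m) + jacobsthalRatio (suc m))  ∎
  where
  open ℚ.≤-Reasoning
  0≤ratio = proj₁ (jacobsthalRatio-bounds (suc m))
  m+1≡[1+m]+0 : ι m + 1ℚ ≡ ι (suc m) + 0ℚ
  m+1≡[1+m]+0 = trans (ℚ.+-comm (ι m) 1ℚ) (trans (sym (ι-suc m)) (sym (ℚ.+-identityʳ (ι (suc m)))))

mid-comm : ∀ u v → mid u v ≡ mid v u
mid-comm u v = cong (λ s → ½ * s + ⅙) (ℚ.+-comm u v)

mid-mono-≤ : ∀ {u u′ v v′} → u ≤ℚ u′ → v ≤ℚ v′ → mid u v ≤ℚ mid u′ v′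
mid-mono-≤ u≤u′ v≤v′ = ℚ.+-monoˡ-≤ ⅙ (½*+-mono-≤ u≤u′ v≤v′)

Bounded : ℕ → ℚ → ℚ → Set
Bounded m u v = u ≤ℚ peak m × v ≤ℚ peak m × mid u v ≤ℚ peak (suc m)

bounded-left : ∀ {m u v} → Bounded m u v → Bounded (suc m) (mid u v) v
bounded-left {m} (_ , v≤ , mid≤) =
  mid≤ , ℚ.≤-trans v≤ (peak-mono m) , ℚ.≤-trans (mid-mono-≤ mid≤ v≤) (ℚ.≤-reflexive (sym (peak-suc (suc m))))

bounded-right : ∀ {m u v} → Bounded m u v → Bounded (suc m) u (mid u v)
bounded-right {m} (u≤ , _ , mid≤) =
  ℚ.≤-trans u≤ (peak-mono m) , mid≤ ,
  ℚ.≤-trans (mid-mono-≤ u≤ mid≤) (ℚ.≤-reflexive (trans (mid-comm (peak m) (peak (suc m))) (sym (peak-suc (suc m)))))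

Level : ℕ → ℕ → Set
Level m t = 2 ^ m ≤ t × t < 2 ^ suc m

Level-2* : ∀ {m t} → Level m t ⇔ Level (suc m) (2 ℕ.* t)
Level-2* {m} {t} = mk⇔
  (λ (lo , hi) → ℕ.*-monoʳ-≤ 2 lo , ℕ.*-monoʳ-< 2 hi)
  (λ (lo , hi) → ℕ.*-cancelˡ-≤ 2 lo , ℕ.*-cancelˡ-< 2 t (2 ^ suc m) hi)

Level-2*+1 : ∀ {m t} → Level m t ⇔ Level (suc m) (suc (2 ℕ.* t))
Level-2*+1 {m} {t} = mk⇔
  (λ (lo , hi) → ℕ.m≤n⇒m≤1+n (ℕ.*-monoʳ-≤ 2 lo) , ℕ.≤-trans 2t+1<2[t+1] (ℕ.*-monoʳ-≤ 2 hi))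
  (λ (lo , hi) → ℕ.≤-pred (ℕ.*-cancelˡ-< 2 (2 ^ m) (suc t) (ℕ.≤-<-trans lo 2t+1<2[t+1])) ,
                 ℕ.*-cancelˡ-< 2 t (2 ^ suc m) (ℕ.<-trans (ℕ.n<1+n (2 ℕ.* t)) hi))
  where
  2t+1<2[t+1] : suc (2 ℕ.* t) < 2 ℕ.* suc t
  2t+1<2[t+1] = ℕ.≤-reflexive (sym (ℕ.*-suc 2 t))

Level-left : ∀ {m k} → Level m (suc k) ⇔ Level (suc m) (suc (suc (2 ℕ.* k)))
Level-left {m} {k} = subst (λ t → Level m (suc k) ⇔ Level (suc m) t) (ℕ.*-suc 2 k) (Level-2* {m} {suc k})

Level-right : ∀ {m k} → Level m (suc k) ⇔ Level (suc m) (suc (suc (suc (2 ℕ.* k))))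
Level-right {m} {k} = subst (λ t → Level m (suc k) ⇔ Level (suc m) (suc t)) (ℕ.*-suc 2 k) (Level-2*+1 {m} {suc k})

¬Level-suc-1 : ∀ {m} → ¬ Level (suc m) 1
¬Level-suc-1 {m} (lo , _) = contradiction (ℕ.≤-trans (ℕ.*-monoʳ-≤ 2 (ℕ.m^n>0 2 m)) lo) λ { (s≤s ()) }

data Position : ℕ → Set where
  root  : Position 0
  left  : ∀ k → Position (suc (2 ℕ.* k))
  right : ∀ k → Position (suc (suc (2 ℕ.* k)))

position : ∀ k → Position k
position zero = root
position (suc k) with position k
... | root    = left 0
... | left j  = right j
... | right j = subst Position (cong suc (ℕ.*-suc 2 j)) (left (suc j))

left-step : ∀ m j → Bounded m (g (suc j)) (g j) → Bounded (suc m) (g (suc (suc (2 ℕ.* j)))) (g (suc (2 ℕ.* j)))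
left-step m j b = subst₂ (Bounded (suc m)) (sym (g-even j)) (sym (g-odd j)) (bounded-left {m} b)

right-step : ∀ m j → Bounded m (g (suc j)) (g j) → Bounded (suc m) (g (suc (suc (suc (2 ℕ.* j))))) (g (suc (suc (2 ℕ.* j))))
right-step m j b = subst₂ (Bounded (suc m)) (sym (g-odd-suc j)) (sym (g-even j)) (bounded-right {m} b)

g-bounded : ∀ m k → Level m (suc k) → Bounded m (g (suc k)) (g k)
g-bounded zero    zero    _ = ℚ.≤ᵇ⇒≤ _ , ℚ.≤ᵇ⇒≤ _ , ℚ.≤ᵇ⇒≤ _
g-bounded zero    (suc k) (_ , s≤s (s≤s ()))
g-bounded (suc m) k       = bounded-at (position k)
  where
  bounded-at : ∀ {k} → Position k → Level (suc m) (suc k) → Bounded (suc m) (g (suc k)) (g k)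
  bounded-at root      lvl = contradiction lvl (¬Level-suc-1 {m})
  bounded-at (left j)  lvl = left-step m j (g-bounded m j (Equivalence.from (Level-left {m} {j}) lvl))
  bounded-at (right j) lvl = right-step m j (g-bounded m j (Equivalence.from (Level-right {m} {j}) lvl))

Consecutive : ℕ → ℚ → ℚ → Set
Consecutive m a b = Σ ℕ λ k → Level m (suc k) × g (suc k) ≡ a × g k ≡ b

peak-attained : ∀ m → Consecutive m (peak m) (peak (ℕ.pred m)) × Consecutive m (peak (ℕ.pred m)) (peak m)
peak-attained zero    = (0 , (s≤s z≤n , s≤s (s≤s z≤n)) , refl , refl) , (0 , (s≤s z≤n , s≤s (s≤s z≤n)) , refl , refl)
peak-attained (suc m) = children (peak-attained m)
  where
  children : Consecutive m (peak m) (peak (ℕ.pred m)) × Consecutive m (peak (ℕ.pred m)) (peak m) →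
             Consecutive (suc m) (peak (suc m)) (peak m) × Consecutive (suc m) (peak m) (peak (suc m))
  children ((k , lvl , g₁ , g₀) , (k′ , lvl′ , g₁′ , g₀′)) =
    (suc (2 ℕ.* k′) , Equivalence.to (Level-left {m} {k′}) lvl′ , left-top , trans (g-odd k′) g₀′) ,
    (suc (suc (2 ℕ.* k)) , Equivalence.to (Level-right {m} {k}) lvl , trans (g-odd-suc k) g₁ , right-bottom)
    where
    left-top : g (suc (suc (2 ℕ.* k′))) ≡ peak (suc m)
    left-top = trans (g-even k′) (trans (cong₂ mid g₁′ g₀′) (trans (mid-comm (peak (ℕ.pred m)) (peak m)) (sym (peak-suc m))))
    right-bottom : g (suc (suc (2 ℕ.* k))) ≡ peak (suc m)
    right-bottom = trans (g-even k) (trans (cong₂ mid g₁ g₀) (sym (peak-suc m)))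

corollary7 : (m : ℕ) →
    (Σ ℕ (λ t → (2 ^ m ≤ t) × (t < 2 ^ suc m) × (g t ≡ bound m)))
    × ((t : ℕ) → 2 ^ m ≤ t → t < 2 ^ suc m → g t ≤ℚ bound m)
corollary7 m = attained (proj₁ (peak-attained m)) , bounded
  where
  attained : Consecutive m (peak m) (peak (ℕ.pred m)) → Σ ℕ (λ t → (2 ^ m ≤ t) × (t < 2 ^ suc m) × (g t ≡ bound m))
  attained (k , (lo , hi) , g≡peak , _) = suc k , lo , hi , trans g≡peak (sym (bound≡peak m))
  bounded : (t : ℕ) → 2 ^ m ≤ t → t < 2 ^ suc m → g t ≤ℚ bound m
  bounded zero    lo _  = contradiction lo (ℕ.<⇒≱ (ℕ.m^n>0 2 m))
  bounded (suc k) lo hi = subst (g (suc k) ≤ℚ_) (sym (bound≡peak m)) (proj₁ (g-bounded m k (lo , hi)))
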